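{- Let $A,B$ be process templates and consider disjunctive systems. For every $n \geq |B|+1$: if the disjunctive system $(A,B)^{(1,n)}$ has a deadlock, then the disjunctive system $(A,B)^{(1,n+1)}$ has a deadlock.
   Context: A process template is $U=(Q_U,\mathrm{init}_U,\Sigma_U,\delta_U)$ where $Q_U$ is a finite set of states containing the initial state $\mathrm{init}_U$, $\Sigma_U$ is a finite input alphabet, and $\delta_U \subseteq Q_U \times \Sigma_U \times \mathcal{P}(Q_A \cup Q_B) \times Q_U$ is a guarded transition relation (the third component is the guard). Templates $A$ and $B$ have disjoint state sets and disjoint input alphabets; $|B|$ denotes $|Q_B|$. The system $(A,B)^{(1,n)}$ consists of one process $A$ (a copy of template $A$) and $n$ processes $B_1,\dots,B_n$ (copies of $B$) in interleaving composition. A global state $s$ assigns a local state $s(p)$ to each process $p$, and a global input $e$ assigns an input $e(p)$ of the respective alphabet to each process; the initial global state has every process in its template's initial state. A local transition $(q,\sigma,g,q')$ of process $p$ is enabled for $(s,e)$ if $s(p)=q$, $e(p)=\sigma$ and the guard is satisfied; in a disjunctive system the guard $g$ is satisfied for $p$ in $s$ iff some process $p'\neq p$ has $s(p')\in g$. A process is enabled for $(s,e)$ if at least one of its local transitions is enabled. A global transition from $s$ with input $e$ replaces the local state of exactly one process $p$ by $q'$ according to an enabled local transition $(s(p),e(p),g,q')$ of $p$. A path is a sequence of configurations $(s_1,e_1,p_1),(s_2,e_2,p_2),\dots$ where $p_t$ is the process that moves at moment $t$ (yielding $s_{t+1}$), a configuration $(s,e,\bot)$ occurs exactly when all processes are disabled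 for $(s,e)$, and for every process $p$ and moment $t$, $e_{t+1}(p)=e_t(p)$ unless $p$ moves at moment $t$. A run is a maximal path starting in the initial global state; it is either infinite or ends in a configuration $(s,e,\bot)$. A run is globally deadlocked if it is finite; an infinite run is locally deadlocked (for process $p$) if from some moment on $p$ is disabled forever. A run is deadlocked if it is locally or globally deadlocked, and a system has a deadlock if it has a deadlocked run. -}

module Defs where

open import Data.Nat using (ℕ; zero; suc; _≤_; _<_)
open import Data.Fin using (Fin)
open import Data.Bool using (Bool; true)
open import Data.Sum using (_⊎_; inj₁; inj₂)
open import Data.Product using (Σ; _×_)
open import Data.List using (List)
open import Data.List.Membership.Propositional using (_∈_)
open import Relation.Nullary using (¬_)
open import Relation.Binary.PropositionalEquality using (_≡_; _≢_)

-- States of template A are Fin qa, states of template B are Fin qb;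
-- the disjoint union Q_A ∪ Q_B is Fin qa ⊎ Fin qb.
-- A guard is a subset of Q_A ∪ Q_B, given by its characteristic function.
Guard : ℕ → ℕ → Set
Guard qa qb = Fin qa ⊎ Fin qb → Bool

record Trans (q s qa qb : ℕ) : Set where
  constructor trans
  field
    src : Fin q
    inp : Fin s
    grd : Guard qa qb
    tgt : Fin q

record Template (q s qa qb : ℕ) : Set where
  field
    init : Fin q
    δ    : List (Trans q s qa qb)

data Proc (n : ℕ) : Set where
  procA : Proc n
  procB : Fin n → Proc n

module System {qa qb sa sb : ℕ}
              (A : Template qa sa qa qb) (B : Template qb sb qa qb) (n : ℕ) where

  record GState : Set where
    constructor gstate
    field
      stA : Fin qa
      stB : Fin n → Fin qb
  open GState public

  record GInput : Set where
    constructor ginput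
    field
      inA : Fin sa
      inB : Fin n → Fin sb
  open GInput public

  IsInit : GState → Set
  IsInit s = stA s ≡ Template.init A × (∀ j → stB s j ≡ Template.init B)

  -- disjunctive guard satisfaction: some OTHER process is in a state of g
  SatA : Guard qa qb → GState → Set
  SatA g s = Σ (Fin n) λ j → g (inj₂ (stB s j)) ≡ true

  SatB : Fin n → Guard qa qb → GState → Set
  SatB i g s = g (inj₁ (stA s)) ≡ true
             ⊎ Σ (Fin n) λ j → j ≢ i × g (inj₂ (stB s j)) ≡ true

  EnabledTr : (p : Proc n) → GState → GInput → Set
  EnabledTr procA s e =
    Σ (Trans qa sa qa qb) λ τ → τ ∈ Template.δ A
      × Trans.src τ ≡ stA s × Trans.inp τ ≡ inA e × SatA (Trans.grd τ) s
  EnabledTr (procB i) s e =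
    Σ (Trans qb sb qa qb) λ τ → τ ∈ Template.δ B
      × Trans.src τ ≡ stB s i × Trans.inp τ ≡ inB e i × SatB i (Trans.grd τ) s

  Enabled : Proc n → GState → GInput → Set
  Enabled p s e = EnabledTr p s e

  AllDisabled : GState → GInput → Set
  AllDisabled s e = ∀ p → ¬ Enabled p s e

  Step : GState → GInput → Proc n → GState → GInput → Set
  Step s e procA s' e' =
    (Σ (Trans qa sa qa qb) λ τ → τ ∈ Template.δ A
       × Trans.src τ ≡ stA s × Trans.inp τ ≡ inA e × SatA (Trans.grd τ) s
       × stA s' ≡ Trans.tgt τ)
    × (∀ j → stB s' j ≡ stB s j)
    × (∀ j → inB e' j ≡ inB e j)
  Step s e (procB i) s' e' =
    (Σ (Trans qb sb qa qb) λ τ → τ ∈ Template.δ B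
       × Trans.src τ ≡ stB s i × Trans.inp τ ≡ inB e i × SatB i (Trans.grd τ) s
       × stB s' i ≡ Trans.tgt τ)
    × (∀ j → j ≢ i → stB s' j ≡ stB s j)
    × stA s' ≡ stA s
    × inA e' ≡ inA e
    × (∀ j → j ≢ i → inB e' j ≡ inB e j)

  -- a finite run: configurations (s t, e t, p t) for t < k are moves,
  -- configuration k is (s k, e k, ⊥) with all processes disabled
  GloballyDeadlocked : Set
  GloballyDeadlocked =
    Σ ℕ λ k → Σ (ℕ → GState) λ s → Σ (ℕ → GInput) λ e → Σ (ℕ → Proc n) λ p →
      IsInit (s 0)
      × (∀ t → t < k → Step (s t) (e t) (p t) (s (suc t)) (e (suc t)))
      × AllDisabled (s k) (e k)

  LocallyDeadlocked : Set
  LocallyDeadlocked =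
    Σ (ℕ → GState) λ s → Σ (ℕ → GInput) λ e → Σ (ℕ → Proc n) λ p →
      IsInit (s 0)
      × (∀ t → Step (s t) (e t) (p t) (s (suc t)) (e (suc t)))
      × (Σ (Proc n) λ q → Σ ℕ λ T → ∀ t → T ≤ t → ¬ Enabled q (s t) (e t))

  HasDeadlock : Set
  HasDeadlock = GloballyDeadlocked ⊎ LocallyDeadlocked

-- Add a process B₀ that shadows a chosen B_j of a deadlocked run, repeating each move of B_j.
-- A disjunctive guard only asks whether some other process occupies a state, so B₀ enables
-- nothing new as long as its state is also visible from elsewhere. For a global deadlock,
-- pick j by pigeonhole (n > |B|) so that another process shares the final state of B_j; the
-- final configuration then stays deadlocked. For a local deadlock of q, pick j with B_j ≠ q
-- (n ≥ 2): B₀'s state was visible to q through B_j just before or just after each move,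
-- when q was disabled, so q stays disabled.
module Submission where

open import Defs hiding (trans)
open import Data.Nat as ℕ using (ℕ; zero; suc; _≤_; _<_; s≤s; _≤′_; ≤′-refl; ≤′-step)
open import Data.Nat.Properties using (≤-refl; ≤-trans; ≤-<-trans; n<1+n; n≤1+n; m≤n⇒m≤1+n; ≤⇒≤′)
open import Data.Fin using (Fin; zero; suc; _≟_)
open import Data.Fin.Properties using (pigeonhole; <⇒≢; suc-injective; nonZeroIndex)
open import Data.Vec.Functional using (_∷_)
open import Data.Bool using (Bool; true; false)
open import Data.Sum using (_⊎_; inj₁; inj₂; [_,_]; reduce)
open import Data.Product using (Σ; _×_; _,_; proj₁)
open import Data.Unit using (⊤; tt)
open import Data.Empty using (⊥-elim)
open import Function using (_∘_)
open import Relation.Nullary using (Dec; yes; no)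
open import Relation.Nullary.Decidable using (map′)
open import Relation.Binary.PropositionalEquality using (_≡_; _≢_; refl; sym; trans; cong; subst)

-- Refining an ℕ-indexed sequence of steps: every step t with D t is split in two.
-- The phase (t , false) is the moment before step t, (t , true) the middle of a split step.
module Refinement {D : ℕ → Set} (D? : (t : ℕ) → Dec (D t)) where

  Phase : Set
  Phase = ℕ × Bool

  advance : ∀ {t} → Dec (D t) → Phase
  advance {t} (yes _) = t , true
  advance {t} (no _)  = suc t , false

  next : Phase → Phase
  next (t , false) = advance (D? t)
  next (t , true)  = suc t , false

  phase : ℕ → Phase
  phase zero    = 0 , false
  phase (suc u) = next (phase u)

  moment : ℕ → ℕ
  moment u = proj₁ (phase u)

  Admissible : Phase → Set
  Admissible (t , false) = ⊤
  Admissible (t , true)  = D t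

  next-admissible : ∀ c → Admissible (next c)
  next-admissible (t , false) with D? t
  ... | yes d = d
  ... | no _  = tt
  next-admissible (t , true) = tt

  phase-admissible : ∀ u → Admissible (phase u)
  phase-admissible zero    = tt
  phase-admissible (suc u) = next-admissible (phase u)

  moment-next : ∀ c → proj₁ c ≤ proj₁ (next c)
  moment-next (t , false) with D? t
  ... | yes _ = ≤-refl
  ... | no _  = n≤1+n t
  moment-next (t , true) = n≤1+n t

  moment-mono′ : ∀ {u v} → u ≤′ v → moment u ≤ moment v
  moment-mono′ ≤′-refl          = ≤-refl
  moment-mono′ (≤′-step {v} u≤v) = ≤-trans (moment-mono′ u≤v) (moment-next (phase v))

  moment-mono : ∀ {u v} → u ≤ v → moment u ≤ moment v
  moment-mono = moment-mono′ ∘ ≤⇒≤′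

  next≡start⇒moment< : ∀ {t} c → next c ≡ (t , false) → proj₁ c < t
  next≡start⇒moment< (t′ , false) eq with D? t′
  next≡start⇒moment< (t′ , false) ()   | yes _
  next≡start⇒moment< (t′ , false) refl | no _  = n<1+n t′
  next≡start⇒moment< (t′ , true)  refl = n<1+n t′

  moment-before-start : ∀ {t u v} → phase u ≡ (t , false) → v < u → moment v < t
  moment-before-start {u = suc u} eq (s≤s v≤u) =
    ≤-<-trans (moment-mono v≤u) (next≡start⇒moment< (phase u) eq)

  reach-start : ∀ t → Σ ℕ λ u → phase u ≡ (t , false)
  reach-start zero = 0 , refl
  reach-start (suc t) with reach-start t
  ... | u , eq with D? t in d
  ... | yes _ = suc (suc u) , cong next (trans (cong next eq) (cong advance d))
  ... | no _  = suc u , trans (cong next eq) (cong advance d)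

  eventually-after : ∀ t → Σ ℕ λ u → ∀ v → u ≤ v → t ≤ moment v
  eventually-after t with reach-start t
  ... | u , eq = u , λ v u≤v → subst (_≤ moment v) (cong proj₁ eq) (moment-mono u≤v)

embed : ∀ {n} → Proc n → Proc (suc n)
embed procA     = procA
embed (procB i) = procB (suc i)

procB-injective : ∀ {n} {i j : Fin n} → procB i ≡ procB j → i ≡ j
procB-injective refl = refl

_≟procB_ : ∀ {n} (q : Proc n) (j : Fin n) → Dec (q ≡ procB j)
procA   ≟procB j = no λ ()
procB i ≟procB j = map′ (cong procB) procB-injective (i ≟ j)

distinct-procB : ∀ {n} → 1 < n → (q : Proc n) → Σ (Fin n) λ j → q ≢ procB j
distinct-procB {suc zero} (s≤s ()) _
distinct-procB {suc (suc _)} _ procA           = zero , λ ()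
distinct-procB {suc (suc _)} _ (procB zero)    = suc zero , λ ()
distinct-procB {suc (suc _)} _ (procB (suc _)) = zero , λ ()

module _ {a} {A : Set a} {n : ℕ} where

  ∷-pointwise : ∀ {c : A} {f f′ : Fin n → A} →
                (∀ y → f′ y ≡ f y) → ∀ y → (c ∷ f′) y ≡ (c ∷ f) y
  ∷-pointwise f′≗f zero    = refl
  ∷-pointwise f′≗f (suc y) = f′≗f y

  ∷-pointwise-except-suc : ∀ {c : A} {f f′ : Fin n → A} {i} →
                           (∀ y → y ≢ i → f′ y ≡ f y) →
                           ∀ y → y ≢ suc i → (c ∷ f′) y ≡ (c ∷ f) y
  ∷-pointwise-except-suc f′≗f zero    _      = refl
  ∷-pointwise-except-suc f′≗f (suc y) y≢suci = f′≗f y (y≢suci ∘ cong suc)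

  ∷-pointwise-except-zero : ∀ {c c′ : A} {f : Fin n → A} →
                            ∀ y → y ≢ zero → (c′ ∷ f) y ≡ (c ∷ f) y
  ∷-pointwise-except-zero zero    y≢0 = ⊥-elim (y≢0 refl)
  ∷-pointwise-except-zero (suc y) _   = refl

-- (A,B)^(1,n) inside (A,B)^(1,n+1): the new process B₀ has index zero, B_i becomes B_{i+1}.
module Extension {qa qb sa sb : ℕ}
                 (A : Template qa sa qa qb) (B : Template qb sb qa qb) (n : ℕ) where
  private
    module S = System A B n
    module T = System A B (suc n)

  extend : S.GState → Fin qb → T.GState
  extend s c = T.gstate (S.stA s) (c ∷ S.stB s)

  extendInput : S.GInput → Fin sb → T.GInput
  extendInput e d = T.ginput (S.inA e) (d ∷ S.inB e)

  clone : Fin n → S.GState → T.GState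
  clone j s = extend s (S.stB s j)

  cloneInput : Fin n → S.GInput → T.GInput
  cloneInput j e = extendInput e (S.inB e j)

  Visible : Proc n → S.GState → Fin qb → Set
  Visible procA     s c = Σ (Fin n) λ y → S.stB s y ≡ c
  Visible (procB i) s c = Σ (Fin n) λ y → y ≢ i × S.stB s y ≡ c

  visible-clone : ∀ {q j} s → q ≢ procB j → Visible q s (S.stB s j)
  visible-clone {procA}   {j} s _      = j , refl
  visible-clone {procB i} {j} s q≢Bj = j , (λ j≡i → q≢Bj (cong procB (sym j≡i))) , refl

  visible-twin : ∀ {j} s → Visible (procB j) s (S.stB s j) → ∀ i → Visible (procB i) s (S.stB s j)
  visible-twin {j} s twin i with i ≟ j
  ... | yes refl = twin
  ... | no i≢j   = visible-clone s (i≢j ∘ procB-injective)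

  Agree : Proc n → S.GState → S.GInput → S.GState → S.GInput → Set
  Agree procA     s e s′ e′ = S.stA s ≡ S.stA s′ × S.inA e ≡ S.inA e′
  Agree (procB i) s e s′ e′ = S.stB s i ≡ S.stB s′ i × S.inB e i ≡ S.inB e′ i

  agree-refl : ∀ q {s e} → Agree q s e s e
  agree-refl procA     = refl , refl
  agree-refl (procB i) = refl , refl

  step-frame : ∀ {s e p s′ e′} q → S.Step s e p s′ e′ → q ≢ p → Agree q s e s′ e′
  step-frame {p = procA}   procA     _                           q≢p = ⊥-elim (q≢p refl)
  step-frame {p = procA}   (procB k) (_ , fixB , fixInB)         _   = sym (fixB k) , sym (fixInB k)
  step-frame {p = procB i} procA     (_ , _ , fixA , fixInA , _) _   = sym fixA , sym fixInA
  step-frame {p = procB i} (procB k) (_ , fixB , _ , _ , fixInB) q≢p =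
    sym (fixB k (q≢p ∘ cong procB)) , sym (fixInB k (q≢p ∘ cong procB))

  clone-init : ∀ {s} j → S.IsInit s → T.IsInit (clone j s)
  clone-init j (initA , initB) = initA , λ { zero → initB j ; (suc y) → initB y }

  satB-embed : ∀ {g s c i} → S.SatB i g s → T.SatB (suc i) g (extend s c)
  satB-embed (inj₁ gA)             = inj₁ gA
  satB-embed (inj₂ (x , x≢i , gx)) = inj₂ (suc x , x≢i ∘ suc-injective , gx)

  satB-shadow : ∀ {g s c i} → S.SatB i g s → T.SatB zero g (extend s c)
  satB-shadow (inj₁ gA)           = inj₁ gA
  satB-shadow (inj₂ (x , _ , gx)) = inj₂ (suc x , (λ ()) , gx)

  step-embed : ∀ {s e q s′ e′ c c′ d d′} → c ≡ c′ → d ≡ d′ → S.Step s e q s′ e′ →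
               T.Step (extend s c) (extendInput e d) (embed q) (extend s′ c′) (extendInput e′ d′)
  step-embed {q = procA} refl refl ((τ , τ∈δ , src , inp , (x , gx) , tgt) , fixB , fixInB) =
    (τ , τ∈δ , src , inp , (suc x , gx) , tgt) , ∷-pointwise fixB , ∷-pointwise fixInB
  step-embed {q = procB i} refl refl ((τ , τ∈δ , src , inp , sat , tgt) , fixB , fixA , fixInA , fixInB) =
    (τ , τ∈δ , src , inp , satB-embed {Trans.grd τ} sat , tgt) ,
    ∷-pointwise-except-suc fixB , fixA , fixInA , ∷-pointwise-except-suc fixInB

  step-shadow : ∀ {s e j s′ e′} → S.Step s e (procB j) s′ e′ →
                T.Step (clone j s) (cloneInput j e) (procB zero)
                       (extend s (S.stB s′ j)) (extendInput e (S.inB e′ j))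
  step-shadow ((τ , τ∈δ , src , inp , sat , tgt) , _) =
    (τ , τ∈δ , src , inp , satB-shadow {Trans.grd τ} sat , tgt) ,
    ∷-pointwise-except-zero , refl , refl , ∷-pointwise-except-zero

  enabled-embed : ∀ q {s e s′ e′ c d} → Visible q s′ c → Agree q s e s′ e′ →
                  T.Enabled (embed q) (extend s c) (extendInput e d) →
                  S.Enabled q s e ⊎ S.Enabled q s′ e′
  enabled-embed procA (y , refl) (sameA , sameInA) (τ , τ∈δ , src , inp , (zero , gc)) =
    inj₂ (τ , τ∈δ , trans src sameA , trans inp sameInA , (y , gc))
  enabled-embed procA _ _ (τ , τ∈δ , src , inp , (suc x , gx)) =
    inj₁ (τ , τ∈δ , src , inp , (x , gx))
  enabled-embed (procB i) _ _ (τ , τ∈δ , src , inp , inj₁ gA) =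
    inj₁ (τ , τ∈δ , src , inp , inj₁ gA)
  enabled-embed (procB i) (y , y≢i , refl) (sameB , sameInB) (τ , τ∈δ , src , inp , inj₂ (zero , _ , gc)) =
    inj₂ (τ , τ∈δ , trans src sameB , trans inp sameInB , inj₂ (y , y≢i , gc))
  enabled-embed (procB i) _ _ (τ , τ∈δ , src , inp , inj₂ (suc x , sx≢si , gx)) =
    inj₁ (τ , τ∈δ , src , inp , inj₂ (x , sx≢si ∘ cong suc , gx))

  enabled-clone : ∀ q {s e j} → Visible q s (S.stB s j) →
                  T.Enabled (embed q) (clone j s) (cloneInput j e) → S.Enabled q s e
  enabled-clone q visible = reduce ∘ enabled-embed q visible (agree-refl q)

  enabled-clone-zero : ∀ {s e j} → Visible (procB j) s (S.stB s j) →
                       T.Enabled (procB zero) (clone j s) (cloneInput j e) → S.Enabled (procB j) s e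
  enabled-clone-zero _ (τ , τ∈δ , src , inp , inj₁ gA) = τ , τ∈δ , src , inp , inj₁ gA
  enabled-clone-zero _ (_ , _ , _ , _ , inj₂ (zero , 0≢0 , _)) = ⊥-elim (0≢0 refl)
  enabled-clone-zero {s} {j = j} (y , y≢j , sy≡sj) (τ , τ∈δ , src , inp , inj₂ (suc x , _ , gx))
    with x ≟ j
  ... | yes refl = τ , τ∈δ , src , inp ,
                   inj₂ (y , y≢j , subst (λ c → Trans.grd τ (inj₂ c) ≡ true) (sym sy≡sj) gx)
  ... | no x≢j   = τ , τ∈δ , src , inp , inj₂ (x , x≢j , gx)

  clone-allDisabled : ∀ {s e j} → Visible (procB j) s (S.stB s j) →
                      S.AllDisabled s e → T.AllDisabled (clone j s) (cloneInput j e)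
  clone-allDisabled {s} {e} {j} twin dead procA =
    dead procA ∘ enabled-clone procA {s} {e} {j} (visible-clone {procA} {j} s λ ())
  clone-allDisabled {s} {e} {j} twin dead (procB zero) =
    dead (procB j) ∘ enabled-clone-zero {s} {e} twin
  clone-allDisabled {s} {e} {j} twin dead (procB (suc i)) =
    dead (procB i) ∘ enabled-clone (procB i) {s} {e} {j} (visible-twin s twin i)

  -- Every move of B_j is performed twice, first by B₀ and then by B_j, so B₀ and B_j
  -- are in the same local state at every phase (t , false).
  module ShadowRun (s : ℕ → S.GState) (e : ℕ → S.GInput) (p : ℕ → Proc n) (j : Fin n) where
    open Refinement (λ t → p t ≟procB j) public

    StepAt : ℕ → Proc n → Set
    StepAt t q = S.Step (s t) (e t) q (s (suc t)) (e (suc t))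

    state : Phase → T.GState
    state (t , false) = clone j (s t)
    state (t , true)  = extend (s t) (S.stB (s (suc t)) j)

    input : Phase → T.GInput
    input (t , false) = cloneInput j (e t)
    input (t , true)  = extendInput (e t) (S.inB (e (suc t)) j)

    moverOf : ∀ {t} → Dec (p t ≡ procB j) → Proc (suc n)
    moverOf     (yes _) = procB zero
    moverOf {t} (no _)  = embed (p t)

    mover : Phase → Proc (suc n)
    mover (t , false) = moverOf (p t ≟procB j)
    mover (t , true)  = procB (suc j)

    shadow-init : S.IsInit (s 0) → T.IsInit (state (phase 0))
    shadow-init = clone-init j

    shadow-step : ∀ c → Admissible c → StepAt (proj₁ c) (p (proj₁ c)) →
                  T.Step (state c) (input c) (mover c) (state (next c)) (input (next c))
    shadow-step (t , false) _ step with p t ≟procB j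
    ... | yes pt≡Bj = step-shadow (subst (StepAt t) pt≡Bj step)
    ... | no pt≢Bj with sameBj , sameInBj ← step-frame (procB j) step (pt≢Bj ∘ sym) =
      step-embed sameBj sameInBj step
    shadow-step (t , true) pt≡Bj step = step-embed {q = procB j} refl refl (subst (StepAt t) pt≡Bj step)

    shadow-enabled : ∀ {q} c → q ≢ procB j → Admissible c → StepAt (proj₁ c) (p (proj₁ c)) →
                     T.Enabled (embed q) (state c) (input c) →
                     S.Enabled q (s (proj₁ c)) (e (proj₁ c)) ⊎ S.Enabled q (s (suc (proj₁ c))) (e (suc (proj₁ c)))
    shadow-enabled {q} (t , false) q≢Bj _ _ =
      inj₁ ∘ enabled-clone q (visible-clone (s t) q≢Bj)
    shadow-enabled {q} (t , true) q≢Bj pt≡Bj step =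
      enabled-embed q (visible-clone (s (suc t)) q≢Bj) (step-frame q (subst (StepAt t) pt≡Bj step) q≢Bj)

  twin-exists : suc qb ≤ n → ∀ s → Σ (Fin n) λ j → Visible (procB j) s (S.stB s j)
  twin-exists qb<n s with pigeonhole qb<n (S.stB s)
  ... | i , j , i<j , si≡sj = j , i , <⇒≢ i<j , si≡sj

  global-deadlock : suc qb ≤ n → S.GloballyDeadlocked → T.GloballyDeadlocked
  global-deadlock qb<n (k , s , e , p , init , steps , dead)
    with j , twin ← twin-exists qb<n (s k)
    with u , at-k ← ShadowRun.reach-start s e p j k =
    let open ShadowRun s e p j in
    u , state ∘ phase , input ∘ phase , mover ∘ phase , shadow-init init ,
    (λ v v<u → shadow-step (phase v) (phase-admissible v) (steps (moment v) (moment-before-start at-k v<u))) ,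
    subst (λ c → T.AllDisabled (state c) (input c)) (sym at-k) (clone-allDisabled twin dead)

  two-processes : suc qb ≤ n → 1 < n
  two-processes qb<n = ≤-trans (s≤s (ℕ.>-nonZero⁻¹ qb {{nonZeroIndex (Template.init B)}})) qb<n

  local-deadlock : suc qb ≤ n → S.LocallyDeadlocked → T.LocallyDeadlocked
  local-deadlock qb<n (s , e , p , init , steps , q , t₀ , dead)
    with j , q≢Bj ← distinct-procB (two-processes qb<n) q
    with u , after ← ShadowRun.eventually-after s e p j t₀ =
    let open ShadowRun s e p j in
    state ∘ phase , input ∘ phase , mover ∘ phase , shadow-init init ,
    (λ v → shadow-step (phase v) (phase-admissible v) (steps (moment v))) ,
    embed q , u , λ v u≤v →
      [ dead (moment v) (after v u≤v) , dead (suc (moment v)) (m≤n⇒m≤1+n (after v u≤v)) ]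
      ∘ shadow-enabled (phase v) q≢Bj (phase-admissible v) (steps (moment v))

lemma3 : {qa qb sa sb : ℕ} (A : Template qa sa qa qb) (B : Template qb sb qa qb)
         (n : ℕ) → suc qb ≤ n →
         System.HasDeadlock A B n → System.HasDeadlock A B (suc n)
lemma3 A B n qb<n (inj₁ global) = inj₁ (Extension.global-deadlock A B n qb<n global)
lemma3 A B n qb<n (inj₂ local)  = inj₂ (Extension.local-deadlock A B n qb<n local)
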